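{- Let $\mathcal{M}$ be an $n$-maniplex with a weight function $\omega\colon E(\mathcal{M})\to\mathbb{Z}_k$. Then the edge-coloured cross-cover $\mathcal{M}^\omega$ has the string property if and only if $\omega(C)=0$ for every $4$-cycle $C$ of $\mathcal{M}$ whose edges alternate between two colours $i,j$ with $|i-j|>1$.
   Context: An $n$-maniplex is a connected $n$-valent simple graph with a proper edge-colouring by $\{0,\dots,n-1\}$ satisfying the string property: whenever $|i-j|>1$, the subgraph formed by edges of colours $i$ and $j$ is a disjoint union of $4$-cycles. For a weight function $\omega\colon E(\mathcal{M})\to\mathbb{Z}_k$, the cross-cover $\mathcal{M}^\omega$ has vertex set $V(\mathcal{M})\times\mathbb{Z}_k$, with $(u,i)$ adjacent to $(v,\omega(e)-i)$ for every edge $e=uv$ of $\mathcal{M}$ and every $i\in\mathbb{Z}_k$; each such edge receives the colour of $e$. For a closed walk $W=(u_0,\dots,u_m)$ with edges $e_j=u_ju_{j+1}$, $\omega(W)=\sum_{j=0}^{m-1}(-1)^j\omega(e_j)$. -}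

module Defs where

open import Data.Nat using (ℕ; suc; _+_; _∸_; _<_; NonZero)
open import Data.Nat.DivMod using (_mod_)
open import Data.Fin using (Fin; toℕ)
open import Data.List using (List; []; _∷_)
open import Data.Product using (Σ; _×_; _,_; ∃)
open import Data.Sum using (_⊎_)
open import Relation.Binary.PropositionalEquality using (_≡_; _≢_)

module _ {k : ℕ} .{{_ : NonZero k}} where
  infixl 6 _⊕_ _⊝_
  0ₖ : Fin k
  0ₖ = 0 mod k

  _⊕_ : Fin k → Fin k → Fin k
  a ⊕ b = (toℕ a + toℕ b) mod k

  ⊖_ : Fin k → Fin k
  ⊖ a = (k ∸ toℕ a) mod k

  _⊝_ : Fin k → Fin k → Fin k
  a ⊝ b = a ⊕ (⊖ b)


-- Edge-coloured graphs with colours Fin n in which every vertex has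
-- exactly one edge of each colour: given by the colour-i neighbour maps
-- r i : V → V (involutions).  The colour-i edge at x is {x , r i x}.

Far : {n : ℕ} → Fin n → Fin n → Set
Far i j = suc (toℕ i) < toℕ j ⊎ suc (toℕ j) < toℕ i

-- A walk is given by a start vertex and the sequence of edge colours.
endpoint : {n : ℕ} {V : Set} → (Fin n → V → V) → V → List (Fin n) → V
endpoint r x []       = x
endpoint r x (c ∷ cs) = endpoint r (r c x) cs

FourCycleAt : {n : ℕ} {V : Set} → (Fin n → V → V) → Fin n → Fin n → V → Set
FourCycleAt r i j x =
  let x₁ = r i x ; x₂ = r j x₁ ; x₃ = r i x₂ in
  (r j x₃ ≡ x)
  × (x ≢ x₁) × (x ≢ x₂) × (x ≢ x₃)
  × (x₁ ≢ x₂) × (x₁ ≢ x₃) × (x₂ ≢ x₃)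

-- String property: for |i - j| > 1 the subgraph of edges of colours i, j
-- is a disjoint union of 4-cycles (since each vertex has exactly one
-- i-edge and one j-edge, this says every vertex lies on an alternating
-- i,j 4-cycle).
StringProperty : {n : ℕ} {V : Set} → (Fin n → V → V) → Set
StringProperty {n} r = (i j : Fin n) → Far i j → ∀ x → FourCycleAt r i j x

record Maniplex (n : ℕ) : Set₁ where
  field
    V        : Set
    r        : Fin n → V → V
    invol    : ∀ i x → r i (r i x) ≡ x
    noLoop   : ∀ i x → r i x ≢ x
    noMulti  : ∀ i j x → i ≢ j → r i x ≢ r j x
    connected : ∀ x y → ∃ λ (cs : List (Fin n)) → endpoint r x cs ≡ y
    string   : StringProperty r

-- Weight function ω : E(M) → ℤ_k.  The colour-i edge {x , r i x} gets
-- weight w i x, which must not depend on the chosen endpoint.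

record Weight {n : ℕ} (M : Maniplex n) (k : ℕ) .{{_ : NonZero k}} : Set where
  open Maniplex M
  field
    w     : Fin n → V → Fin k
    w-sym : ∀ i x → w i (r i x) ≡ w i x

module _ {n k : ℕ} .{{_ : NonZero k}} {M : Maniplex n} (ω : Weight M k) where
  open Maniplex M
  open Weight ω

  coverR : Fin n → V × Fin k → V × Fin k
  coverR i (u , a) = r i u , (w i u ⊝ a)

  -- ω(W) = Σ_j (-1)^j ω(e_j) for the walk starting at u with colours cs.
  walkWeight : V → List (Fin n) → Fin k
  walkWeight u []       = 0ₖ
  walkWeight u (c ∷ cs) = w c u ⊝ walkWeight (r c u) cs

{-# OPTIONS --safe #-}
-- In the cross-cover a colour-c edge acts on the fibre coordinate by the
-- reflection a ↦ ω(e) − a, and two reflections compose to a translation.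
-- Hence the lift of an even walk W starting at (u , a) ends at fibre
-- coordinate a − ω(W), so a closed even walk of M lifts to a closed walk iff
-- ω(W) = 0.  The four vertices of a lifted alternating 4-cycle are distinct
-- because their projections to M are.
module Submission where

open import Algebra.Bundles using (AbelianGroup)
open import Algebra.Consequences.Propositional using (comm∧idʳ⇒id; comm∧invʳ⇒inv)
open import Algebra.Structures using (IsAbelianGroup)
import Algebra.Properties.AbelianGroup as AbelianGroupProperties
open import Data.Fin using (Fin; toℕ)
open import Data.Fin.Properties using (toℕ-injective; toℕ<n; toℕ-fromℕ<)
open import Data.List using (List; []; _∷_)
open import Data.Nat using (ℕ; NonZero; >-nonZero⁻¹; _+_; _∸_; _%_)
open import Data.Nat.DivMod using (_mod_; %-distribˡ-+; m%n%n≡m%n; n%n≡0; m<n⇒m%n≡m)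
open import Data.Nat.Properties using (+-assoc; +-comm; +-identityʳ; m+[n∸m]≡n; <⇒≤)
open import Data.Product using (_×_; _,_; proj₁; proj₂)
open import Function.Bundles using (_⇔_; mk⇔; Equivalence)
open import Level using (Level; 0ℓ)
open import Relation.Binary.PropositionalEquality
  using (_≡_; _≢_; refl; sym; trans; cong; cong₂; isEquivalence; module ≡-Reasoning)
open import Defs

module _ {k : ℕ} .{{_ : NonZero k}} where
  open ≡-Reasoning

  mod-cong : ∀ {m n} → m % k ≡ n % k → m mod k ≡ n mod k
  mod-cong {m} {n} eq = toℕ-injective (begin
    toℕ (m mod k) ≡⟨ toℕ-fromℕ< _ ⟩
    m % k         ≡⟨ eq ⟩
    n % k         ≡⟨ toℕ-fromℕ< _ ⟨
    toℕ (n mod k) ∎)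

  mod-toℕ : (a : Fin k) → toℕ a mod k ≡ a
  mod-toℕ a = toℕ-injective (trans (toℕ-fromℕ< _) (m<n⇒m%n≡m (toℕ<n a)))

  +-mod-absorbˡ : ∀ m n → (toℕ (m mod k) + n) mod k ≡ (m + n) mod k
  +-mod-absorbˡ m n = mod-cong (begin
    (toℕ (m mod k) + n) % k     ≡⟨ cong (λ t → (t + n) % k) (toℕ-fromℕ< _) ⟩
    (m % k + n) % k             ≡⟨ %-distribˡ-+ (m % k) n k ⟩
    (m % k % k + n % k) % k     ≡⟨ cong (λ t → (t + n % k) % k) (m%n%n≡m%n m k) ⟩
    (m % k + n % k) % k         ≡⟨ %-distribˡ-+ m n k ⟨
    (m + n) % k                 ∎)

  +-mod-absorbʳ : ∀ m n → (m + toℕ (n mod k)) mod k ≡ (m + n) mod k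
  +-mod-absorbʳ m n = begin
    (m + toℕ (n mod k)) mod k ≡⟨ cong (_mod k) (+-comm m _) ⟩
    (toℕ (n mod k) + m) mod k ≡⟨ +-mod-absorbˡ n m ⟩
    (n + m) mod k             ≡⟨ cong (_mod k) (+-comm n m) ⟩
    (m + n) mod k             ∎

  ⊕-comm : (a b : Fin k) → a ⊕ b ≡ b ⊕ a
  ⊕-comm a b = cong (_mod k) (+-comm (toℕ a) (toℕ b))

  ⊕-assoc : (a b c : Fin k) → (a ⊕ b) ⊕ c ≡ a ⊕ (b ⊕ c)
  ⊕-assoc a b c = begin
    (a ⊕ b) ⊕ c                       ≡⟨ +-mod-absorbˡ (toℕ a + toℕ b) (toℕ c) ⟩
    (toℕ a + toℕ b + toℕ c) mod k     ≡⟨ cong (_mod k) (+-assoc (toℕ a) (toℕ b) (toℕ c)) ⟩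
    (toℕ a + (toℕ b + toℕ c)) mod k   ≡⟨ +-mod-absorbʳ (toℕ a) (toℕ b + toℕ c) ⟨
    a ⊕ (b ⊕ c)                       ∎

  ⊕-identityʳ : (a : Fin k) → a ⊕ 0ₖ ≡ a
  ⊕-identityʳ a = begin
    a ⊕ 0ₖ              ≡⟨ +-mod-absorbʳ (toℕ a) 0 ⟩
    (toℕ a + 0) mod k   ≡⟨ cong (_mod k) (+-identityʳ (toℕ a)) ⟩
    toℕ a mod k         ≡⟨ mod-toℕ a ⟩
    a                   ∎

  ⊕-inverseʳ : (a : Fin k) → a ⊕ (⊖ a) ≡ 0ₖ
  ⊕-inverseʳ a = begin
    a ⊕ (⊖ a)                   ≡⟨ +-mod-absorbʳ (toℕ a) (k ∸ toℕ a) ⟩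
    (toℕ a + (k ∸ toℕ a)) mod k ≡⟨ cong (_mod k) (m+[n∸m]≡n (<⇒≤ (toℕ<n a))) ⟩
    k mod k                     ≡⟨ mod-cong (trans (n%n≡0 k) (sym (m<n⇒m%n≡m (>-nonZero⁻¹ k)))) ⟩
    0ₖ                          ∎

  ℤₖ-isAbelianGroup : IsAbelianGroup _≡_ _⊕_ 0ₖ ⊖_
  ℤₖ-isAbelianGroup = record
    { isGroup = record
      { isMonoid = record
        { isSemigroup = record
          { isMagma = record { isEquivalence = isEquivalence ; ∙-cong = cong₂ _⊕_ }
          ; assoc = ⊕-assoc
          }
        ; identity = comm∧idʳ⇒id ⊕-comm ⊕-identityʳ
        }
      ; inverse = comm∧invʳ⇒inv ⊕-comm ⊕-inverseʳ
      ; ⁻¹-cong = cong ⊖_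
      }
    ; comm = ⊕-comm
    }

  ℤₖ : AbelianGroup 0ℓ 0ℓ
  ℤₖ = record { isAbelianGroup = ℤₖ-isAbelianGroup }

module _ {a ℓ : Level} (G : AbelianGroup a ℓ) where
  open AbelianGroup G
    using (setoid; _≈_; _∙_; _⁻¹; ε; _-_; ∙-congˡ; ∙-congʳ; assoc; comm; identityʳ)
    renaming (sym to ≈-sym; trans to ≈-trans)
  open AbelianGroupProperties G
    using (⁻¹-anti-homo‿-; ⁻¹-involutive; ⁻¹-∙-comm; ε⁻¹≈ε; ⁻¹-injective; identityʳ-unique)
  open import Relation.Binary.Reasoning.Setoid setoid

  [y-[x-a]]-z≈a-[x-[y-z]] : ∀ x y z a → y - (x - a) - z ≈ a - (x - (y - z))
  [y-[x-a]]-z≈a-[x-[y-z]] x y z a = begin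
    y - (x - a) - z             ≈⟨ ∙-congʳ (∙-congˡ (⁻¹-anti-homo‿- x a)) ⟩
    y ∙ (a - x) - z             ≈⟨ ∙-congʳ (comm y (a - x)) ⟩
    (a - x) ∙ y - z             ≈⟨ assoc (a - x) y (z ⁻¹) ⟩
    (a - x) ∙ (y - z)           ≈⟨ assoc a (x ⁻¹) (y - z) ⟩
    a ∙ (x ⁻¹ ∙ (y - z))        ≈⟨ ∙-congˡ (∙-congˡ (⁻¹-involutive (y - z))) ⟨
    a ∙ (x ⁻¹ ∙ (y - z) ⁻¹ ⁻¹)  ≈⟨ ∙-congˡ (⁻¹-∙-comm x ((y - z) ⁻¹)) ⟩
    a - (x - (y - z))           ∎

  x-ε≈x : ∀ x → x - ε ≈ x
  x-ε≈x x = ≈-trans (∙-congˡ ε⁻¹≈ε) (identityʳ x)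

  x-y≈x⇒y≈ε : ∀ x y → x - y ≈ x → y ≈ ε
  x-y≈x⇒y≈ε x y eq = ⁻¹-injective (≈-trans (identityʳ-unique x (y ⁻¹) eq) (≈-sym ε⁻¹≈ε))

evenWalk : {n : ℕ} → List (Fin n × Fin n) → List (Fin n)
evenWalk []             = []
evenWalk ((i , j) ∷ ps) = i ∷ j ∷ evenWalk ps

module _ {n : ℕ} {V W : Set} {r : Fin n → V → V} {s : Fin n → W → W}
         (p : W → V) (p-hom : ∀ i x → p (s i x) ≡ r i (p x)) where

  endpoint-hom : ∀ x cs → p (endpoint s x cs) ≡ endpoint r (p x) cs
  endpoint-hom x []       = refl
  endpoint-hom x (c ∷ cs) = trans (endpoint-hom (s c x) cs) (cong (λ y → endpoint r y cs) (p-hom c x))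

  endpoint-≢-lift : ∀ x cs ds → endpoint r (p x) cs ≢ endpoint r (p x) ds →
                    endpoint s x cs ≢ endpoint s x ds
  endpoint-≢-lift x cs ds ne eq =
    ne (trans (sym (endpoint-hom x cs)) (trans (cong p eq) (endpoint-hom x ds)))

  FourCycleAt-lift : ∀ {i j x} → endpoint s x (i ∷ j ∷ i ∷ j ∷ []) ≡ x →
                     FourCycleAt r i j (p x) → FourCycleAt s i j x
  FourCycleAt-lift {i} {j} {x} closed (_ , d01 , d02 , d03 , d12 , d13 , d23) =
    closed , lift [] ij₁ d01 , lift [] ij₂ d02 , lift [] ij₃ d03
           , lift ij₁ ij₂ d12 , lift ij₁ ij₃ d13 , lift ij₂ ij₃ d23
    where
    lift : ∀ cs ds → endpoint r (p x) cs ≢ endpoint r (p x) ds → endpoint s x cs ≢ endpoint s x ds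
    lift = endpoint-≢-lift x
    ij₁ ij₂ ij₃ : List (Fin n)
    ij₁ = i ∷ []
    ij₂ = i ∷ j ∷ []
    ij₃ = i ∷ j ∷ i ∷ []

module _ {n k : ℕ} .{{_ : NonZero k}} {M : Maniplex n} (ω : Weight M k) where
  open Maniplex M
  open Weight ω

  lift-evenWalk : ∀ u a ps →
    endpoint (coverR ω) (u , a) (evenWalk ps)
      ≡ (endpoint r u (evenWalk ps) , a ⊝ walkWeight ω u (evenWalk ps))
  lift-evenWalk u a []             = cong (u ,_) (sym (x-ε≈x ℤₖ a))
  lift-evenWalk u a ((i , j) ∷ ps) = trans (lift-evenWalk u₂ a₂ ps)
    (cong (_ ,_) ([y-[x-a]]-z≈a-[x-[y-z]] ℤₖ (w i u) (w j u₁) (walkWeight ω u₂ (evenWalk ps)) a))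
    where
    u₁ u₂ : V
    a₂ : Fin k
    u₁ = r i u
    u₂ = r j u₁
    a₂ = w j u₁ ⊝ (w i u ⊝ a)

  lift-closed⇔walkWeight≡0 : ∀ u a ps → endpoint r u (evenWalk ps) ≡ u →
    endpoint (coverR ω) (u , a) (evenWalk ps) ≡ (u , a) ⇔ walkWeight ω u (evenWalk ps) ≡ 0ₖ
  lift-closed⇔walkWeight≡0 u a ps closed = mk⇔
    (λ eq → x-y≈x⇒y≈ε ℤₖ a _ (cong proj₂ (trans (sym (lift-evenWalk u a ps)) eq)))
    (λ eq → trans (lift-evenWalk u a ps)
              (cong₂ _,_ closed (trans (cong (a ⊝_) eq) (x-ε≈x ℤₖ a))))

lemma3p8 : {n k : ℕ} .{{_ : NonZero k}} (M : Maniplex n) (ω : Weight M k) →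
    StringProperty (coverR ω)
      ⇔ ((i j : Fin n) → Far i j → (u : Maniplex.V M) →
           FourCycleAt (Maniplex.r M) i j u →
           walkWeight ω u (i ∷ j ∷ i ∷ j ∷ []) ≡ 0ₖ)
lemma3p8 M ω = mk⇔
  (λ string-cover i j far u cycle →
     Equivalence.to (lift-closed⇔walkWeight≡0 ω u 0ₖ (alternating i j) (proj₁ cycle))
                    (proj₁ (string-cover i j far (u , 0ₖ))))
  (λ weight≡0 i j far (u , a) →
     let cycle = string i j far u in
     FourCycleAt-lift {r = r} {s = coverR ω} proj₁ (λ _ _ → refl)
       (Equivalence.from (lift-closed⇔walkWeight≡0 ω u a (alternating i j) (proj₁ cycle))
                         (weight≡0 i j far u cycle))
       cycle)
  where
  open Maniplex M
  alternating : ∀ {n} → Fin n → Fin n → List (Fin n × Fin n)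
  alternating i j = (i , j) ∷ (i , j) ∷ []
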